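{- Let $n$ be a positive integer and let $\frac{a_1}{b_1} < \frac{a_2}{b_2} < \cdots$ be the Farey sequence of order $n$. Let $\frac{a_k}{b_k}$, $\frac{a}{b}$ and $\frac{a_l}{b_l}$ be fractions in this sequence (with $\frac{a}{b}$ in lowest terms) such that $\frac{a_k}{b_k} \le \frac{a}{b} \le \frac{a_l}{b_l}$. If $l - k \le \frac{n+b+1}{2b}$, then $\frac{a_k}{b_k}$ and $\frac{a_l}{b_l}$ are similarly ordered, i.e. $(a_l - a_k)(b_l - b_k) \ge 0$.
   Context: For a positive integer $n$, the Farey sequence of order $n$ is the increasing sequence $\frac{a_1}{b_1} < \frac{a_2}{b_2} < \cdots$ of all reduced fractions $\frac{a}{b}$ with $0 \le \frac{a}{b} \le 1$ and $1 \le b \le n$, each written in lowest terms. Two such fractions $\frac{a}{b}$ and $\frac{a'}{b'}$ are called similarly ordered if $(a'-a)(b'-b) \ge 0$. -}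

module Defs where

open import Data.Nat using (ℕ; zero; suc; _+_; _*_; _≤_; _<_; _<?_)
open import Data.Nat.Coprimality using (Coprime; coprime?)
open import Data.List using (List; length; filter; upTo; concatMap; map; _∷_; [])
open import Data.Product using (_×_; _,_; proj₁; proj₂)
open import Relation.Nullary.Decidable using (_×-dec_)

InFarey : ℕ → ℕ × ℕ → Set
InFarey n (a , b) = 1 ≤ b × b ≤ n × a ≤ b × Coprime a b

-- Order of fractions (denominators positive): a/b < c/d  iff  a*d < c*b.
_<F_ : ℕ × ℕ → ℕ × ℕ → Set
(a , b) <F (c , d) = a * d < c * b

_≤F_ : ℕ × ℕ → ℕ × ℕ → Set
(a , b) ≤F (c , d) = a * d ≤ c * b

-- All candidate pairs (a , b) with 1 ≤ b ≤ n and 0 ≤ a ≤ b (before reduction).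
candidates : ℕ → List (ℕ × ℕ)
candidates n = concatMap (λ b → map (λ a → (a , suc b)) (upTo (suc (suc b)))) (upTo n)

-- The terms of the Farey sequence of order n (in no particular order).
fareyTerms : ℕ → List (ℕ × ℕ)
fareyTerms n = filter (λ p → coprime? (proj₁ p) (proj₂ p)) (candidates n)

-- Position (0-based) of the fraction x in the (increasing) Farey sequence of
-- order n: the number of Farey fractions strictly less than x.
-- So the Farey sequence is  x₀ < x₁ < ⋯  with  fareyIndex n xᵢ ≡ i.
fareyIndex : ℕ → ℕ × ℕ → ℕ
fareyIndex n (a , b) =
  length (filter (λ p → (proj₁ p * b) <? (a * proj₂ p)) (fareyTerms n))

module Submission where

-- Let x = p/q ≤ a/b ≤ y = r/s. If they are not similarly ordered then p < r and s < q (the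
-- opposite orientation contradicts x ≤ y), and the index difference counts the Farey fractions
-- in [x, y). Write a/b − p/q = D₁/(bq) and r/s − a/b = D₂/(bs); since y − x ≥ 1/s,
-- qb ≤ D₁s + D₂q. For b ≥ 2 (b = 1 cannot occur) the fractions c/d = a/b ∓ 1/(bd), i.e. the solutions of
-- ad − bc = ±1, are reduced and their denominators form a residue class mod b, so roughly
-- (n − lo)/b of them have lo ≤ d ≤ n. A left one lies in [x, y) as soon as q ≤ D₁d, a right one
-- as soon as s < D₂d. If y = a/b then q ≤ D₁ and every left one qualifies; if x = a/b then
-- s < D₂ and every right one qualifies; otherwise D₁ ≥ 2 or D₂ ≥ 2 and those with d > n/2
-- qualify. Together with x and a/b this gives more than (n + b + 1)/(2b) fractions in [x, y).

open import Defs
open import Data.Nat using (ℕ; suc; _+_; _*_; _∸_; _≤_)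
open import Data.Integer using (+_; _-_) renaming (_*_ to _*ℤ_; _≤_ to _≤ℤ_)
open import Data.Nat.Coprimality using (Coprime)
open import Data.Product using (_,_)

open import Data.Nat using (zero; pred; _<_; _≤?_; _<?_; _≟_; z≤n; s≤s; NonZero; >-nonZero)
open import Data.Nat.Properties
open import Data.Nat.DivMod using (_/_; _%_; m≡m%n+[m/n]*n; m%n<n; m/n*n≤m)
open import Data.Nat.Divisibility using (_∣_; divides; ∣-antisym; ∣-refl)
open import Data.Nat.Coprimality using (coprime?; coprime-Bézout; Bézout-coprime; coprime-divisor; 0-coprimeTo-m⇒m≡1)
import Data.Nat.Coprimality as Coprime
open import Data.Nat.GCD using (module Bézout)
open import Data.Nat.Tactic.RingSolver using (solve; solve-∀)
open import Data.Integer using (+≤+)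
import Data.Integer.Properties as ℤ
import Data.Integer.Tactic.RingSolver as ℤ-Solver
open import Data.Product using (_×_; proj₁; proj₂; ∃; ∃₂)
open import Data.Product.Properties using (≡-dec)
open import Data.Sum using (_⊎_; inj₁; inj₂)
open import Data.List using (List; []; _∷_; _++_; length; filter)
open import Data.List.Properties using (filter-notAll; length-++)
open import Data.List.Relation.Unary.All as All using (All)
import Data.List.Relation.Unary.All.Properties as Allₚ
import Data.List.Relation.Unary.AllPairs as AllPairs
open import Data.List.Relation.Unary.Any using (here; there)
open import Data.List.Relation.Unary.Unique.Propositional using (Unique)
import Data.List.Relation.Unary.Unique.Propositional.Properties as Uniqueₚ
open import Data.List.Relation.Binary.Subset.Propositional using (_⊆_)
open import Data.List.Membership.Propositional using (_∈_; lose)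
open import Data.List.Membership.Propositional.Properties using (∈-filter⁺; ∈-concatMap⁺; ∈-map⁺; ∈-upTo⁺)
open import Data.Empty using (⊥; ⊥-elim)
open import Function using (_∘_)
open import Level using (0ℓ)
open import Relation.Nullary using (¬_; yes; no; Dec)
open import Relation.Nullary.Decidable using (¬?)
open import Relation.Unary using (Pred; Decidable)
open import Relation.Unary.Properties using (_∩?_; ∁?)
open import Relation.Binary.Definitions using (DecidableEquality)
open import Relation.Binary.PropositionalEquality

module _ {A : Set} (_≟ᴬ_ : DecidableEquality A) where

  Unique-⊆⇒length≤ : ∀ {xs ys : List A} → Unique xs → xs ⊆ ys → length xs ≤ length ys
  Unique-⊆⇒length≤ {[]} _ _ = z≤n
  Unique-⊆⇒length≤ {x ∷ xs} {ys} (x∉xs AllPairs.∷ xs-unique) x∷xs⊆ys =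
    ≤-trans (s≤s (Unique-⊆⇒length≤ xs-unique xs⊆ys-x))
            (filter-notAll (¬? ∘ (x ≟ᴬ_)) ys (lose (x∷xs⊆ys (here refl)) (λ x≢x → x≢x refl)))
    where
      xs⊆ys-x : xs ⊆ filter (¬? ∘ (x ≟ᴬ_)) ys
      xs⊆ys-x y∈xs = ∈-filter⁺ (¬? ∘ (x ≟ᴬ_)) (x∷xs⊆ys (there y∈xs)) (All.lookup x∉xs y∈xs)

module _ {A : Set} {P Q : Pred A 0ℓ} (P? : Decidable P) (Q? : Decidable Q) where

  length-filter-split : (∀ {x} → P x → Q x) →
    ∀ xs → length (filter Q? xs) ≡ length (filter P? xs) + length (filter (Q? ∩? ∁? P?) xs)
  length-filter-split P⇒Q [] = refl
  length-filter-split P⇒Q (x ∷ xs) with P? x | Q? x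
  ... | yes _  | yes _  = cong suc (length-filter-split P⇒Q xs)
  ... | yes px | no ¬qx = ⊥-elim (¬qx (P⇒Q px))
  ... | no _   | yes _  = trans (cong suc (length-filter-split P⇒Q xs)) (sym (+-suc _ _))
  ... | no _   | no _   = length-filter-split P⇒Q xs

-- Stated through projections so that λ f → f <F? (a , b) is exactly the filter of fareyIndex.
_<F?_ : (f g : ℕ × ℕ) → Dec (f <F g)
f <F? g = proj₁ f * proj₂ g <? proj₁ g * proj₂ f

<F-≤F-trans : ∀ {c d p q r s} → .{{NonZero s}} →
              (c , d) <F (p , q) → (p , q) ≤F (r , s) → (c , d) <F (r , s)
<F-≤F-trans {c} {d} {p} {q} {r} {s} c/d<p/q p/q≤r/s = *-cancelʳ-< q (c * s) (r * d) (begin-strict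
  c * s * q   ≡⟨ solve (c ∷ s ∷ q ∷ []) ⟩
  c * q * s   <⟨ *-monoˡ-< s c/d<p/q ⟩
  p * d * s   ≡⟨ solve (p ∷ d ∷ s ∷ []) ⟩
  d * (p * s) ≤⟨ *-monoʳ-≤ d p/q≤r/s ⟩
  d * (r * q) ≡⟨ solve (d ∷ r ∷ q ∷ []) ⟩
  r * d * q   ∎)
  where open ≤-Reasoning

≤F-trans : ∀ {p q a b r s} → .{{NonZero b}} → (p , q) ≤F (a , b) → (a , b) ≤F (r , s) → (p , q) ≤F (r , s)
≤F-trans {p} {q} {a} {b} {r} {s} p/q≤a/b a/b≤r/s = *-cancelʳ-≤ (p * s) (r * q) b (begin
  p * s * b   ≡⟨ solve (p ∷ s ∷ b ∷ []) ⟩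
  p * b * s   ≤⟨ *-monoˡ-≤ s p/q≤a/b ⟩
  a * q * s   ≡⟨ solve (a ∷ q ∷ s ∷ []) ⟩
  a * s * q   ≤⟨ *-monoˡ-≤ q a/b≤r/s ⟩
  r * b * q   ≡⟨ solve (r ∷ b ∷ q ∷ []) ⟩
  r * q * b   ∎)
  where open ≤-Reasoning

≤F∧≤den⇒≤num : ∀ {p q r s} → .{{NonZero s}} → (p , q) ≤F (r , s) → q ≤ s → p ≤ r
≤F∧≤den⇒≤num {p} {q} {r} {s} p/q≤r/s q≤s = *-cancelʳ-≤ p r s (begin
  p * s ≤⟨ p/q≤r/s ⟩
  r * q ≤⟨ *-monoʳ-≤ r q≤s ⟩
  r * s ∎)
  where open ≤-Reasoning

Coprime⇒≡den : ∀ {a b c d} → Coprime a b → Coprime c d → a * d ≡ c * b → b ≡ d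
Coprime⇒≡den {a} {b} {c} {d} a⊥b c⊥d ad≡cb = ∣-antisym
  (coprime-divisor (Coprime.sym a⊥b) (divides c ad≡cb))
  (coprime-divisor (Coprime.sym c⊥d) (divides a (sym ad≡cb)))

InFarey⇒∈fareyTerms : ∀ {n c d} → InFarey n (c , d) → (c , d) ∈ fareyTerms n
InFarey⇒∈fareyTerms {n} {c} {suc d} (_ , d<n , c≤d , c⊥d) =
  ∈-filter⁺ (λ f → coprime? (proj₁ f) (proj₂ f))
    (∈-concatMap⁺ _ (lose (∈-upTo⁺ d<n) (∈-map⁺ (_, suc d) (∈-upTo⁺ (s≤s c≤d)))))
    c⊥d

length≤fareyIndex-difference : ∀ n {p q r s} → .{{NonZero s}} → (p , q) ≤F (r , s) →
  ∀ {L} → Unique L → All (λ f → InFarey n f × ¬ f <F (p , q) × f <F (r , s)) L →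
  length L ≤ fareyIndex n (r , s) ∸ fareyIndex n (p , q)
length≤fareyIndex-difference n {p} {q} {r} {s} x≤y {L} L-unique L-between = begin
  length L                          ≤⟨ Unique-⊆⇒length≤ (≡-dec _≟_ _≟_) L-unique L⊆between ⟩
  length (filter between? terms)    ≡⟨ m+n∸m≡n index-x _ ⟨
  index-x + length (filter between? terms) ∸ index-x ≡⟨ cong (_∸ index-x) split ⟨
  index-y ∸ index-x                 ∎
  where
    open ≤-Reasoning
    terms : List (ℕ × ℕ)
    terms = fareyTerms n
    index-x index-y : ℕ
    index-x = fareyIndex n (p , q)
    index-y = fareyIndex n (r , s)
    between? : Decidable (λ f → f <F (r , s) × ¬ f <F (p , q))
    between? = (_<F? (r , s)) ∩? ∁? (_<F? (p , q))
    <x⇒<y : ∀ {f} → f <F (p , q) → f <F (r , s)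
    <x⇒<y {f} f<x = <F-≤F-trans {proj₁ f} {proj₂ f} {p} {q} {r} {s} f<x x≤y
    split : index-y ≡ index-x + length (filter between? terms)
    split = length-filter-split {P = _<F (p , q)} {Q = _<F (r , s)} (_<F? (p , q)) (_<F? (r , s)) (λ {f} → <x⇒<y {f}) terms
    L⊆between : L ⊆ filter between? terms
    L⊆between f∈L with All.lookup L-between f∈L
    ... | f∈F , f≮x , f<y = ∈-filter⁺ between? (InFarey⇒∈fareyTerms f∈F) (f<y , f≮x)

module Neighbours (a b : ℕ) (1<b : 1 < b) where

  instance
    b≢0 : NonZero b
    b≢0 = >-nonZero (<-trans (s≤s z≤n) 1<b)

  Left : ℕ → ℕ → Set
  Left c d = a * d ≡ b * c + 1

  Right : ℕ → ℕ → Set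
  Right c d = b * c ≡ a * d + 1

  left-step : ∀ {c d} → Left c d → Left (c + a) (d + b)
  left-step {c} {d} ad≡bc+1 = begin
    a * (d + b)         ≡⟨ solve (a ∷ d ∷ b ∷ []) ⟩
    a * d + a * b       ≡⟨ cong (_+ a * b) ad≡bc+1 ⟩
    b * c + 1 + a * b   ≡⟨ solve (a ∷ c ∷ b ∷ []) ⟩
    b * (c + a) + 1     ∎
    where open ≡-Reasoning

  right-step : ∀ {c d} → Right c d → Right (c + a) (d + b)
  right-step {c} {d} bc≡ad+1 = begin
    b * (c + a)         ≡⟨ solve (a ∷ c ∷ b ∷ []) ⟩
    b * c + a * b       ≡⟨ cong (_+ a * b) bc≡ad+1 ⟩
    a * d + 1 + a * b   ≡⟨ solve (a ∷ d ∷ b ∷ []) ⟩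
    a * (d + b) + 1     ∎
    where open ≡-Reasoning

  private
    ba≤a[d+b] : ∀ d → b * a ≤ a * (d + b)
    ba≤a[d+b] d = ≤-trans (≤-reflexive (*-comm b a)) (*-monoʳ-≤ a (m≤n+m b d))

  left-a≤num : ∀ {c d} → Left c (d + b) → a ≤ c
  left-a≤num {c} {d} a[d+b]≡bc+1 = ≮⇒≥ λ c<a → <⇒≱ 1<b (+-cancelʳ-≤ (b * c) b 1 (begin
    b + b * c      ≡⟨ *-suc b c ⟨
    b * suc c      ≤⟨ *-monoʳ-≤ b c<a ⟩
    b * a          ≤⟨ ba≤a[d+b] d ⟩
    a * (d + b)    ≡⟨ a[d+b]≡bc+1 ⟩
    b * c + 1      ≡⟨ +-comm (b * c) 1 ⟩
    1 + b * c      ∎))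
    where open ≤-Reasoning

  right-a≤num : ∀ {c d} → Right c (d + b) → a ≤ c
  right-a≤num {c} {d} bc≡a[d+b]+1 = ≮⇒≥ λ c<a → <-irrefl bc≡a[d+b]+1 (begin-strict
    b * c          <⟨ *-monoʳ-< b c<a ⟩
    b * a          ≤⟨ ba≤a[d+b] d ⟩
    a * (d + b)    <⟨ m<m+n _ (s≤s z≤n) ⟩
    a * (d + b) + 1 ∎)
    where open ≤-Reasoning

  left-unstep : ∀ {c d} → Left c (d + b) → ∃ λ c′ → Left c′ d
  left-unstep {c} {d} a[d+b]≡bc+1 = c ∸ a , +-cancelʳ-≡ (a * b) _ _ (begin
    a * d + a * b            ≡⟨ solve (a ∷ d ∷ b ∷ []) ⟩
    a * (d + b)              ≡⟨ a[d+b]≡bc+1 ⟩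
    b * c + 1                ≡⟨ cong (λ c → b * c + 1) (m∸n+n≡m (left-a≤num a[d+b]≡bc+1)) ⟨
    b * (c ∸ a + a) + 1      ≡⟨ expand (c ∸ a) ⟩
    b * (c ∸ a) + 1 + a * b  ∎)
    where
      open ≡-Reasoning
      expand : ∀ c′ → b * (c′ + a) + 1 ≡ b * c′ + 1 + a * b
      expand c′ = solve (c′ ∷ a ∷ b ∷ [])

  right-unstep : ∀ {c d} → Right c (d + b) → ∃ λ c′ → Right c′ d
  right-unstep {c} {d} bc≡a[d+b]+1 = c ∸ a , +-cancelʳ-≡ (a * b) _ _ (begin
    b * (c ∸ a) + a * b      ≡⟨ expand (c ∸ a) ⟨
    b * (c ∸ a + a)          ≡⟨ cong (b *_) (m∸n+n≡m (right-a≤num bc≡a[d+b]+1)) ⟩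
    b * c                    ≡⟨ bc≡a[d+b]+1 ⟩
    a * (d + b) + 1          ≡⟨ solve (a ∷ d ∷ b ∷ []) ⟩
    a * d + 1 + a * b        ∎)
    where
      open ≡-Reasoning
      expand : ∀ c′ → b * (c′ + a) ≡ b * c′ + a * b
      expand c′ = solve (c′ ∷ a ∷ b ∷ [])

  left⇒right : ∀ {c d} → Left c d → Right (pred b * c + 1) (pred b * d)
  left⇒right {c} {d} = shift b 1<b
    where
      -- Multiplying ad − bc = 1 by b − 1 gives b((b − 1)c + 1) − a(b − 1)d = 1.
      shift : ∀ b′ → 1 < b′ → a * d ≡ b′ * c + 1 → b′ * (pred b′ * c + 1) ≡ a * (pred b′ * d) + 1
      shift zero    ()
      shift (suc k) _ ad≡b′c+1 = begin
        suc k * (k * c + 1)       ≡⟨ solve (k ∷ c ∷ []) ⟩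
        k * (suc k * c + 1) + 1   ≡⟨ cong (λ t → k * t + 1) ad≡b′c+1 ⟨
        k * (a * d) + 1           ≡⟨ solve (a ∷ d ∷ k ∷ []) ⟩
        a * (k * d) + 1           ∎
        where open ≡-Reasoning

  right⇒left : ∀ {c d} → Right (suc c) d → Left (pred b * c + (b ∸ 2)) (pred b * d)
  right⇒left {c} {d} = shift b 1<b
    where
      -- Here ad − bc = b − 1, and (b − 1)(b − 1) − b(b − 2) = 1.
      shift : ∀ b′ → 1 < b′ → b′ * suc c ≡ a * d + 1 → a * (pred b′ * d) ≡ b′ * (pred b′ * c + (b′ ∸ 2)) + 1
      shift zero          ()
      shift (suc zero)    (s≤s ())
      shift (suc (suc k)) _ b′[1+c]≡ad+1 = +-cancelʳ-≡ (suc k) _ _ (begin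
        a * (suc k * d) + suc k                     ≡⟨ solve (a ∷ d ∷ k ∷ []) ⟩
        suc k * (a * d + 1)                         ≡⟨ cong (suc k *_) b′[1+c]≡ad+1 ⟨
        suc k * (suc (suc k) * suc c)               ≡⟨ solve (c ∷ k ∷ []) ⟩
        suc (suc k) * (suc k * c + k) + 1 + suc k   ∎)
        where open ≡-Reasoning

  left-or-right : Coprime a b → ∃₂ Left ⊎ ∃₂ Right
  left-or-right a⊥b with coprime-Bézout a⊥b
  ... | Bézout.+- x y 1+yb≡xa = inj₁ (y , x , (begin
    a * x       ≡⟨ *-comm a x ⟩
    x * a       ≡⟨ 1+yb≡xa ⟨
    1 + y * b   ≡⟨ solve (y ∷ b ∷ []) ⟩
    b * y + 1   ∎))
    where open ≡-Reasoning
  ... | Bézout.-+ x y 1+xa≡yb = inj₂ (y , x , (begin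
    b * y       ≡⟨ *-comm b y ⟩
    y * b       ≡⟨ 1+xa≡yb ⟨
    1 + x * a   ≡⟨ solve (x ∷ a ∷ []) ⟩
    a * x + 1   ∎))
    where open ≡-Reasoning

  left-exists : Coprime a b → ∃₂ Left
  left-exists a⊥b with left-or-right a⊥b
  ... | inj₁ solution           = solution
  ... | inj₂ (zero , d , b0≡ad+1) = ⊥-elim (0≢1+n (trans (sym (*-zeroʳ b)) (trans b0≡ad+1 (+-comm (a * d) 1))))
  ... | inj₂ (suc c , d , right)  = _ , _ , right⇒left {c} {d} right

  right-exists : Coprime a b → ∃₂ Right
  right-exists a⊥b with left-or-right a⊥b
  ... | inj₁ (c , d , left) = _ , _ , left⇒right {c} {d} left
  ... | inj₂ solution       = solution

  left-coprime : ∀ {c d} → Left c d → Coprime c d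
  left-coprime {c} {d} ad≡bc+1 = Bézout-coprime {d = 1} (Bézout.-+ b a (begin
    1 + b * (c * 1)   ≡⟨ solve (c ∷ b ∷ []) ⟩
    b * c + 1         ≡⟨ ad≡bc+1 ⟨
    a * d             ≡⟨ solve (a ∷ d ∷ []) ⟩
    a * (d * 1)       ∎))
    where open ≡-Reasoning

  right-coprime : ∀ {c d} → Right c d → Coprime c d
  right-coprime {c} {d} bc≡ad+1 = Bézout-coprime {d = 1} (Bézout.+- b a (begin
    1 + a * (d * 1)   ≡⟨ solve (a ∷ d ∷ []) ⟩
    a * d + 1         ≡⟨ bc≡ad+1 ⟨
    b * c             ≡⟨ solve (c ∷ b ∷ []) ⟩
    b * (c * 1)       ∎))
    where open ≡-Reasoning

  left-num≤den : a ≤ b → ∀ {c d} → Left c d → c ≤ d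
  left-num≤den a≤b {c} {d} ad≡bc+1 = <⇒≤ (*-cancelˡ-< b c d (begin-strict
    b * c       <⟨ m<m+n (b * c) (s≤s z≤n) ⟩
    b * c + 1   ≡⟨ ad≡bc+1 ⟨
    a * d       ≤⟨ *-monoˡ-≤ d a≤b ⟩
    b * d       ∎))
    where open ≤-Reasoning

  right-num≤den : a ≤ b → ∀ {c d} → Right c d → c ≤ d
  right-num≤den a≤b {c} {d} bc≡ad+1 = ≮⇒≥ λ d<c → <⇒≱ 1<b (+-cancelˡ-≤ (b * d) b 1 (begin
    b * d + b   ≡⟨ +-comm (b * d) b ⟩
    b + b * d   ≡⟨ *-suc b d ⟨
    b * suc d   ≤⟨ *-monoʳ-≤ b d<c ⟩
    b * c       ≡⟨ bc≡ad+1 ⟩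
    a * d + 1   ≤⟨ +-monoˡ-≤ 1 (*-monoˡ-≤ d a≤b) ⟩
    b * d + 1   ∎))
    where open ≤-Reasoning

  ¬Left-self : ¬ Left a b
  ¬Left-self ab≡ba+1 = <-irrefl (trans (*-comm b a) ab≡ba+1) (m<m+n (b * a) (s≤s z≤n))

  ¬Right-self : ¬ Right a b
  ¬Right-self ba≡ab+1 = <-irrefl (trans (*-comm a b) ba≡ab+1) (m<m+n (a * b) (s≤s z≤n))

module Progression (n a b : ℕ) (b>0 : 0 < b) (F : ℕ → ℕ → Set)
  (F-step : ∀ {c d} → F c d → F (c + a) (d + b))
  (F-unstep : ∀ {c d} → F c (d + b) → ∃ λ c′ → F c′ d) where

  -- Imported locally: with these constructors in scope, the variable lists passed to the ring
  -- solver, solve (x ∷ y ∷ []), become ambiguous and take very long to elaborate.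
  open import Data.List.Relation.Unary.All using ([]; _∷_)
  open import Data.List.Relation.Unary.AllPairs using ([]; _∷_)

  Band : ℕ → ℕ × ℕ → Set
  Band lo f = F (proj₁ f) (proj₂ f) × lo ≤ proj₂ f × proj₂ f ≤ n

  band-weaken : ∀ {lo lo′ f} → lo ≤ lo′ → Band lo′ f → Band lo f
  band-weaken lo≤lo′ (Ff , lo′≤d , d≤n) = Ff , ≤-trans lo≤lo′ lo′≤d , d≤n

  Window : ℕ → Set
  Window lo = ∃₂ λ c d → F c d × lo ≤ d × d < lo + b

  window-0 : ∀ k {c d} → F c d → d < k + b → Window 0
  window-0 zero Fcd d<b = _ , _ , Fcd , z≤n , d<b
  window-0 (suc k) {c} {d} Fcd d<1+k+b with d <? b
  ... | yes d<b = _ , _ , Fcd , z≤n , d<b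
  ... | no d≮b with F-unstep (subst (F c) (sym (m∸n+n≡m (≮⇒≥ d≮b))) Fcd)
  ...   | _ , F′ = window-0 k F′ (begin-strict
          d ∸ b       ≤⟨ ∸-monoˡ-≤ b (≤-pred d<1+k+b) ⟩
          k + b ∸ b   ≡⟨ m+n∸n≡m k b ⟩
          k           <⟨ m<m+n k b>0 ⟩
          k + b       ∎)
    where open ≤-Reasoning

  window : ∀ lo {c d} → F c d → Window lo
  window zero {d = d} Fcd = window-0 d Fcd (m<m+n d b>0)
  window (suc lo) Fcd with window lo Fcd
  ... | c , d , F′ , lo≤d , d<lo+b with m≤n⇒m<n∨m≡n lo≤d
  ...   | inj₁ lo<d  = c , d , F′ , lo<d , m<n⇒m<1+n d<lo+b
  ...   | inj₂ refl  = c + a , lo + b , F-step F′ , m<m+n lo b>0 , n<1+n (lo + b)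

  run : ℕ → ℕ → ℕ → List (ℕ × ℕ)
  run zero    c d = []
  run (suc k) c d with d ≤? n
  ... | yes _ = (c , d) ∷ run k (c + a) (d + b)
  ... | no _  = []

  run-band : ∀ k {c d} → F c d → All (Band d) (run k c d)
  run-band zero _ = []
  run-band (suc k) {c} {d} Fcd with d ≤? n
  ... | yes d≤n = (Fcd , ≤-refl , d≤n) ∷ All.map (band-weaken (m≤m+n d b)) (run-band k (F-step Fcd))
  ... | no _    = []

  run-unique : ∀ k {c d} → F c d → Unique (run k c d)
  run-unique zero _ = []
  run-unique (suc k) {c} {d} Fcd with d ≤? n
  ... | yes _ = All.map later≢ (run-band k (F-step Fcd)) ∷ run-unique k (F-step Fcd)
    where
      later≢ : ∀ {f} → Band (d + b) f → (c , d) ≢ f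
      later≢ (_ , d+b≤d′ , _) refl = <⇒≱ (m<m+n d b>0) d+b≤d′
  ... | no _  = []

  run-length : ∀ k {c d} → n < d + k → n < length (run k c d) * b + d
  run-length zero {d = d} n<d+0 = subst (n <_) (+-identityʳ d) n<d+0
  run-length (suc k) {c} {d} n<d+1+k with d ≤? n
  ... | no d≰n = ≰⇒> d≰n
  ... | yes _  = begin-strict
    n                 <⟨ run-length k n<d+b+k ⟩
    l * b + (d + b)   ≡⟨ shift l b d ⟩
    suc l * b + d     ∎
    where
      open ≤-Reasoning
      l : ℕ
      l = length (run k (c + a) (d + b))
      n<d+b+k : n < d + b + k
      n<d+b+k = <-≤-trans n<d+1+k (≤-trans (≤-reflexive (+-suc d k)) (+-monoˡ-≤ k (m<m+n d b>0)))
      shift : ∀ l x y → l * x + (y + x) ≡ suc l * x + y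
      shift = solve-∀

  progression : ∀ lo {c d} → F c d →
    ∃ λ L → Unique L × All (Band lo) L × suc n < length L * b + (lo + b)
  progression lo Fcd with window lo Fcd
  ... | c , d , F′ , lo≤d , d<lo+b =
    run (suc n) c d , run-unique (suc n) F′ , All.map (band-weaken lo≤d) (run-band (suc n) F′) ,
    ≤-<-trans (run-length (suc n) (<-≤-trans (n<1+n n) (m≤n+m (suc n) d))) (+-monoʳ-< _ d<lo+b)

n<[1+n/2]*2 : ∀ n → n < suc (n / 2) * 2
n<[1+n/2]*2 n = begin-strict
  n                   ≡⟨ m≡m%n+[m/n]*n n 2 ⟩
  n % 2 + n / 2 * 2   <⟨ +-monoˡ-< (n / 2 * 2) (m%n<n n 2) ⟩
  2 + n / 2 * 2       ∎
  where open ≤-Reasoning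

one-prefix-bound : ∀ {n b k} → b ≤ n → suc n < k * b + (1 + b) → n + b + 1 < 2 * b * suc k
one-prefix-bound {n} {b} {k} b≤n n+1<kb+1+b = begin-strict
  n + b + 1         ≤⟨ +-monoˡ-≤ 1 (+-monoʳ-≤ n b≤n) ⟩
  n + n + 1         <⟨ n<1+n (n + n + 1) ⟩
  suc (n + n + 1)   ≡⟨ solve (n ∷ []) ⟩
  2 * suc n         ≤⟨ *-monoʳ-≤ 2 n+1≤kb+b ⟩
  2 * (k * b + b)   ≡⟨ solve (k ∷ b ∷ []) ⟩
  2 * b * suc k     ∎
  where
    open ≤-Reasoning
    n+1≤kb+b : suc n ≤ k * b + b
    n+1≤kb+b = ≤-pred (≤-trans n+1<kb+1+b (≤-reflexive (+-suc (k * b) b)))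

two-prefix-bound : ∀ {n b k h} → h * 2 ≤ n → suc n < k * b + (suc h + b) → n + b + 1 < 2 * b * suc (suc k)
two-prefix-bound {n} {b} {k} {h} 2h≤n n+1<kb+h+1+b = begin-strict
  n + b + 1                   <⟨ n<1+n (n + b + 1) ⟩
  suc (n + b + 1)             ≡⟨ solve (n ∷ b ∷ []) ⟩
  n + 2 + b                   ≤⟨ +-monoˡ-≤ b n+2≤2[kb+b] ⟩
  2 * (k * b + b) + b         ≤⟨ +-monoʳ-≤ (2 * (k * b + b)) (m≤m+n b b) ⟩
  2 * (k * b + b) + (b + b)   ≡⟨ solve (k ∷ b ∷ []) ⟩
  2 * b * suc (suc k)         ∎
  where
    open ≤-Reasoning
    n+1≤kb+h+b : suc n ≤ k * b + (h + b)
    n+1≤kb+h+b = ≤-pred (≤-trans n+1<kb+h+1+b (≤-reflexive (+-suc (k * b) (h + b))))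
    n+2≤2[kb+b] : n + 2 ≤ 2 * (k * b + b)
    n+2≤2[kb+b] = +-cancelˡ-≤ n (n + 2) (2 * (k * b + b)) (begin
      n + (n + 2)               ≡⟨ solve (n ∷ []) ⟩
      2 * suc n                 ≤⟨ *-monoʳ-≤ 2 n+1≤kb+h+b ⟩
      2 * (k * b + (h + b))     ≡⟨ solve (k ∷ b ∷ h ∷ []) ⟩
      h * 2 + 2 * (k * b + b)   ≤⟨ +-monoˡ-≤ (2 * (k * b + b)) 2h≤n ⟩
      n + 2 * (k * b + b)       ∎)

module Crossing (n p q a b r s D₁ D₂ : ℕ) (1<b : 1 < b)
  (x∈F : InFarey n (p , q)) (ab∈F : InFarey n (a , b)) (y∈F : InFarey n (r , s))
  (aq≡D₁+bp : a * q ≡ D₁ + b * p) (rb≡D₂+as : r * b ≡ D₂ + a * s)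
  (p<r : p < r) (s<q : s < q) where

  open Neighbours a b 1<b

  instance
    q≢0 : NonZero q
    q≢0 = >-nonZero (proj₁ x∈F)
    s≢0 : NonZero s
    s≢0 = >-nonZero (proj₁ y∈F)

  a≤b : a ≤ b
  a≤b = proj₁ (proj₂ (proj₂ ab∈F))

  a⊥b : Coprime a b
  a⊥b = proj₂ (proj₂ (proj₂ ab∈F))

  b≤n : b ≤ n
  b≤n = proj₁ (proj₂ ab∈F)

  q≤n : q ≤ n
  q≤n = proj₁ (proj₂ x∈F)

  s≤n : s ≤ n
  s≤n = proj₁ (proj₂ y∈F)

  p⊥q : Coprime p q
  p⊥q = proj₂ (proj₂ (proj₂ x∈F))

  r⊥s : Coprime r s
  r⊥s = proj₂ (proj₂ (proj₂ y∈F))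

  x≤ab : (p , q) ≤F (a , b)
  x≤ab = ≤-trans (≤-reflexive (*-comm p b)) (≤-trans (m≤n+m (b * p) D₁) (≤-reflexive (sym aq≡D₁+bp)))

  ab≤y : (a , b) ≤F (r , s)
  ab≤y = ≤-trans (m≤n+m (a * s) D₂) (≤-reflexive (sym rb≡D₂+as))

  x<y : (p , q) <F (r , s)
  x<y = begin-strict
    p * s   ≤⟨ *-monoʳ-≤ p (<⇒≤ s<q) ⟩
    p * q   <⟨ *-monoˡ-< q p<r ⟩
    r * q   ∎
    where open ≤-Reasoning

  qb≤D₁s+D₂q : q * b ≤ D₁ * s + D₂ * q
  qb≤D₁s+D₂q = +-cancelʳ-≤ (b * p * s) (q * b) (D₁ * s + D₂ * q) (begin
    q * b + b * p * s             ≤⟨ +-monoʳ-≤ (q * b) (*-monoʳ-≤ (b * p) (<⇒≤ s<q)) ⟩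
    q * b + b * p * q             ≡⟨ solve (q ∷ b ∷ p ∷ []) ⟩
    q * ((1 + p) * b)             ≤⟨ *-monoʳ-≤ q (*-monoˡ-≤ b p<r) ⟩
    q * (r * b)                   ≡⟨ cong (q *_) rb≡D₂+as ⟩
    q * (D₂ + a * s)              ≡⟨ solve (q ∷ D₂ ∷ a ∷ s ∷ []) ⟩
    a * q * s + D₂ * q            ≡⟨ cong (λ t → t * s + D₂ * q) aq≡D₁+bp ⟩
    (D₁ + b * p) * s + D₂ * q     ≡⟨ solve (D₁ ∷ b ∷ p ∷ s ∷ D₂ ∷ q ∷ []) ⟩
    D₁ * s + D₂ * q + b * p * s   ∎)
    where open ≤-Reasoning

  left-≮x : ∀ {c d} → Left c d → q ≤ D₁ * d → ¬ (c , d) <F (p , q)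
  left-≮x {c} {d} ad≡bc+1 q≤D₁d = ≤⇒≯ (*-cancelˡ-≤ b (+-cancelʳ-≤ q (b * (p * d)) (b * (c * q)) (begin
    b * (p * d) + q       ≤⟨ +-monoʳ-≤ (b * (p * d)) q≤D₁d ⟩
    b * (p * d) + D₁ * d  ≡⟨ solve (b ∷ p ∷ d ∷ D₁ ∷ []) ⟩
    (D₁ + b * p) * d      ≡⟨ cong (_* d) aq≡D₁+bp ⟨
    a * q * d             ≡⟨ solve (a ∷ q ∷ d ∷ []) ⟩
    a * d * q             ≡⟨ cong (_* q) ad≡bc+1 ⟩
    (b * c + 1) * q       ≡⟨ solve (b ∷ c ∷ q ∷ []) ⟩
    b * (c * q) + q       ∎)))
    where open ≤-Reasoning

  left-<y : ∀ {c d} → Left c d → (c , d) <F (r , s)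
  left-<y {c} {d} ad≡bc+1 = *-cancelˡ-< b (c * s) (r * d) (begin-strict
    b * (c * s)       <⟨ m<m+n (b * (c * s)) (proj₁ y∈F) ⟩
    b * (c * s) + s   ≡⟨ solve (b ∷ c ∷ s ∷ []) ⟩
    (b * c + 1) * s   ≡⟨ cong (_* s) ad≡bc+1 ⟨
    a * d * s         ≡⟨ solve (a ∷ d ∷ s ∷ []) ⟩
    d * (a * s)       ≤⟨ *-monoʳ-≤ d ab≤y ⟩
    d * (r * b)       ≡⟨ solve (d ∷ r ∷ b ∷ []) ⟩
    b * (r * d)       ∎)
    where open ≤-Reasoning

  right-≮x : ∀ {c d} → Right c d → ¬ (c , d) <F (p , q)
  right-≮x {c} {d} bc≡ad+1 = ≤⇒≯ (<⇒≤ (*-cancelˡ-< b (p * d) (c * q) (begin-strict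
    b * (p * d)       ≡⟨ solve (b ∷ p ∷ d ∷ []) ⟩
    p * b * d         ≤⟨ *-monoˡ-≤ d x≤ab ⟩
    a * q * d         ≡⟨ solve (a ∷ q ∷ d ∷ []) ⟩
    a * d * q         <⟨ m<m+n (a * d * q) (proj₁ x∈F) ⟩
    a * d * q + q     ≡⟨ solve (a ∷ d ∷ q ∷ []) ⟩
    (a * d + 1) * q   ≡⟨ cong (_* q) bc≡ad+1 ⟨
    b * c * q         ≡⟨ solve (b ∷ c ∷ q ∷ []) ⟩
    b * (c * q)       ∎)))
    where open ≤-Reasoning

  right-<y : ∀ {c d} → Right c d → s < D₂ * d → (c , d) <F (r , s)
  right-<y {c} {d} bc≡ad+1 s<D₂d = *-cancelˡ-< b (c * s) (r * d) (begin-strict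
    b * (c * s)         ≡⟨ solve (b ∷ c ∷ s ∷ []) ⟩
    b * c * s           ≡⟨ cong (_* s) bc≡ad+1 ⟩
    (a * d + 1) * s     ≡⟨ solve (a ∷ d ∷ s ∷ []) ⟩
    a * d * s + s       <⟨ +-monoʳ-< (a * d * s) s<D₂d ⟩
    a * d * s + D₂ * d  ≡⟨ solve (a ∷ d ∷ s ∷ D₂ ∷ []) ⟩
    d * (D₂ + a * s)    ≡⟨ cong (d *_) rb≡D₂+as ⟨
    d * (r * b)         ≡⟨ solve (d ∷ r ∷ b ∷ []) ⟩
    b * (r * d)         ∎)
    where open ≤-Reasoning

  left-x⇒D₁≡1 : Left p q → D₁ ≡ 1
  left-x⇒D₁≡1 aq≡bp+1 = +-cancelʳ-≡ (b * p) D₁ 1 (trans (sym aq≡D₁+bp) (trans aq≡bp+1 (+-comm (b * p) 1)))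

  ¬Right-x : ¬ Right p q
  ¬Right-x bp≡aq+1 = <⇒≱ (≤-reflexive (trans (+-comm 1 (a * q)) (trans (sym bp≡aq+1) (*-comm b p)))) x≤ab

  x≢ab : 1 ≤ D₁ → (p , q) ≢ (a , b)
  x≢ab 1≤D₁ refl = <⇒≢ 1≤D₁ (sym (+-cancelʳ-≡ (b * p) D₁ 0 (trans (sym aq≡D₁+bp) (*-comm p b))))

  D₁≡1⇒2≤D₂ : D₁ ≡ 1 → 2 ≤ D₂
  D₁≡1⇒2≤D₂ D₁≡1 = ≮⇒≥ λ D₂<2 → <⇒≱ (begin-strict
    1 * s + D₂ * q ≡⟨ cong (_+ D₂ * q) (*-identityˡ s) ⟩
    s + D₂ * q    ≤⟨ +-monoʳ-≤ s (*-monoˡ-≤ q (≤-pred D₂<2)) ⟩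
    s + 1 * q     <⟨ +-monoˡ-< (1 * q) s<q ⟩
    q + 1 * q     ≡⟨ solve (q ∷ []) ⟩
    2 * q         ≤⟨ *-monoˡ-≤ q 1<b ⟩
    b * q         ≡⟨ *-comm b q ⟩
    q * b         ∎) (≤-trans qb≤D₁s+D₂q (≤-reflexive (cong (λ D → D * s + D₂ * q) D₁≡1)))
    where open ≤-Reasoning

  Between : ℕ × ℕ → Set
  Between f = InFarey n f × ¬ f <F (p , q) × f <F (r , s)

  ManyBetween : Set
  ManyBetween = ∃ λ L → Unique L × All Between L × n + b + 1 < 2 * b * length L

  x-between : Between (p , q)
  x-between = x∈F , <-irrefl refl , x<y

  ab-between : 1 ≤ D₂ → Between (a , b)
  ab-between 1≤D₂ = ab∈F , ≤⇒≯ x≤ab , ≤-trans (+-monoˡ-≤ (a * s) 1≤D₂) (≤-reflexive (sym rb≡D₂+as))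

  module Collect (F : ℕ → ℕ → Set)
    (F-step : ∀ {c d} → F c d → F (c + a) (d + b))
    (F-unstep : ∀ {c d} → F c (d + b) → ∃ λ c′ → F c′ d)
    {c₀ d₀} (F₀ : F c₀ d₀) where

    open Progression n a b (<-trans (s≤s z≤n) 1<b) F F-step F-unstep public

    collect : ∀ lo (P : List (ℕ × ℕ)) → Unique P → All Between P → All (λ f → ¬ F (proj₁ f) (proj₂ f)) P →
      (∀ {f} → Band lo f → Between f) →
      (∀ k → suc n < k * b + (lo + b) → n + b + 1 < 2 * b * (length P + k)) →
      ManyBetween
    collect lo P P-unique P-between P-outside band⇒between bound with progression lo F₀
    ... | L , L-unique , L-band , L-long =
      P ++ L ,
      Uniqueₚ.++⁺ P-unique L-unique (λ (f∈P , f∈L) → All.lookup P-outside f∈P (proj₁ (All.lookup L-band f∈L))) ,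
      Allₚ.++⁺ P-between (All.map band⇒between L-band) ,
      subst (λ k → n + b + 1 < 2 * b * k) (sym (length-++ P)) (bound (length L) L-long)

  module CollectLeft = Collect Left left-step left-unstep (proj₂ (proj₂ (left-exists a⊥b)))
  module CollectRight = Collect Right right-step right-unstep (proj₂ (proj₂ (right-exists a⊥b)))

  left-between : ∀ {lo} → 1 ≤ lo → (∀ {d} → lo ≤ d → q ≤ D₁ * d) → ∀ {f} → CollectLeft.Band lo f → Between f
  left-between 1≤lo q≤D₁d (left , lo≤d , d≤n) =
    (≤-trans 1≤lo lo≤d , d≤n , left-num≤den a≤b left , left-coprime left) , left-≮x left (q≤D₁d lo≤d) , left-<y left

  right-between : ∀ {lo} → 1 ≤ lo → (∀ {d} → lo ≤ d → s < D₂ * d) → ∀ {f} → CollectRight.Band lo f → Between f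
  right-between 1≤lo s<D₂d (right , lo≤d , d≤n) =
    (≤-trans 1≤lo lo≤d , d≤n , right-num≤den a≤b right , right-coprime right) , right-≮x right , right-<y right (s<D₂d lo≤d)

  n<D*d : ∀ {D d} → 2 ≤ D → suc (n / 2) ≤ d → n < D * d
  n<D*d {D} {d} 2≤D lo≤d = <-≤-trans (n<[1+n/2]*2 n) (≤-trans (*-mono-≤ lo≤d 2≤D) (≤-reflexive (*-comm d D)))

  -- Imported only after the last use of the ring solver in this module (see Progression).
  open import Data.List.Relation.Unary.All using ([]; _∷_)
  open import Data.List.Relation.Unary.AllPairs using ([]; _∷_)

  case-D₂≡0 : D₂ ≡ 0 → ManyBetween
  case-D₂≡0 D₂≡0 = CollectLeft.collect 1 ((p , q) ∷ []) ([] ∷ []) (x-between ∷ []) (¬Left-x ∷ [])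
    (left-between ≤-refl λ 1≤d → ≤-trans q≤D₁ (m≤m*n D₁ _ {{>-nonZero 1≤d}}))
    (λ _ → one-prefix-bound b≤n)
    where
      b≡s : b ≡ s
      b≡s = Coprime⇒≡den a⊥b r⊥s (sym (trans rb≡D₂+as (cong (_+ a * s) D₂≡0)))
      q≤D₁ : q ≤ D₁
      q≤D₁ = *-cancelʳ-≤ q D₁ b (≤-trans qb≤D₁s+D₂q (≤-reflexive (begin-equality
        D₁ * s + D₂ * q ≡⟨ cong (λ D → D₁ * s + D * q) D₂≡0 ⟩
        D₁ * s + 0      ≡⟨ +-identityʳ (D₁ * s) ⟩
        D₁ * s          ≡⟨ cong (D₁ *_) b≡s ⟨
        D₁ * b          ∎)))
        where open ≤-Reasoning
      ¬Left-x : ¬ Left p q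
      ¬Left-x left = <⇒≱ (≤-trans (s≤s (proj₁ y∈F)) s<q) (≤-trans q≤D₁ (≤-reflexive (left-x⇒D₁≡1 left)))

  case-D₁≡0 : D₁ ≡ 0 → 1 ≤ D₂ → ManyBetween
  case-D₁≡0 D₁≡0 1≤D₂ = CollectRight.collect 1 ((a , b) ∷ []) ([] ∷ []) (ab-between 1≤D₂ ∷ []) (¬Right-self ∷ [])
    (right-between ≤-refl λ 1≤d → <-≤-trans s<q (≤-trans q≤D₂ (m≤m*n D₂ _ {{>-nonZero 1≤d}})))
    (λ _ → one-prefix-bound b≤n)
    where
      q≡b : q ≡ b
      q≡b = Coprime⇒≡den p⊥q a⊥b (trans (*-comm p b) (sym (trans aq≡D₁+bp (cong (_+ b * p) D₁≡0))))
      q≤D₂ : q ≤ D₂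
      q≤D₂ = *-cancelʳ-≤ q D₂ q (≤-trans (≤-reflexive (cong (q *_) q≡b)) (≤-trans qb≤D₁s+D₂q
        (≤-reflexive (cong (λ D → D * s + D₂ * q) D₁≡0))))

  case-2≤D₁ : 2 ≤ D₁ → 1 ≤ D₂ → ManyBetween
  case-2≤D₁ 2≤D₁ 1≤D₂ = CollectLeft.collect (suc (n / 2)) ((p , q) ∷ (a , b) ∷ [])
    ((x≢ab (<⇒≤ 2≤D₁) ∷ []) ∷ [] ∷ []) (x-between ∷ ab-between 1≤D₂ ∷ [])
    ((λ left → ≤⇒≯ (≤-reflexive (left-x⇒D₁≡1 left)) 2≤D₁) ∷ ¬Left-self ∷ [])
    (left-between (s≤s z≤n) λ lo≤d → <⇒≤ (≤-<-trans q≤n (n<D*d 2≤D₁ lo≤d)))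
    (λ _ → two-prefix-bound (m/n*n≤m n 2))

  case-D₁≡1 : D₁ ≡ 1 → 1 ≤ D₂ → ManyBetween
  case-D₁≡1 D₁≡1 1≤D₂ = CollectRight.collect (suc (n / 2)) ((p , q) ∷ (a , b) ∷ [])
    ((x≢ab (≤-reflexive (sym D₁≡1)) ∷ []) ∷ [] ∷ []) (x-between ∷ ab-between 1≤D₂ ∷ [])
    (¬Right-x ∷ ¬Right-self ∷ [])
    (right-between (s≤s z≤n) λ lo≤d → ≤-<-trans s≤n (n<D*d (D₁≡1⇒2≤D₂ D₁≡1) lo≤d))
    (λ _ → two-prefix-bound (m/n*n≤m n 2))

  many-between : ManyBetween
  many-between with D₂ ≟ 0 | D₁ ≟ 0 | D₁ ≟ 1
  ... | yes D₂≡0 | _        | _        = case-D₂≡0 D₂≡0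
  ... | no D₂≢0  | yes D₁≡0 | _        = case-D₁≡0 D₁≡0 (n≢0⇒n>0 D₂≢0)
  ... | no D₂≢0  | no _     | yes D₁≡1 = case-D₁≡1 D₁≡1 (n≢0⇒n>0 D₂≢0)
  ... | no D₂≢0  | no D₁≢0  | no D₁≢1  = case-2≤D₁ (≤∧≢⇒< (n≢0⇒n>0 D₁≢0) (D₁≢1 ∘ sym)) (n≢0⇒n>0 D₂≢0)

  gap : n + b + 1 < 2 * b * (fareyIndex n (r , s) ∸ fareyIndex n (p , q))
  gap with many-between
  ... | L , L-unique , L-between , many =
    <-≤-trans many (*-monoʳ-≤ (2 * b) (length≤fareyIndex-difference n {p} {q} {r} {s} (<⇒≤ x<y) L-unique L-between))

¬crossing-around-integer : ∀ {n p q a r s} → InFarey n (p , q) → InFarey n (a , 1) → InFarey n (r , s) →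
  (p , q) ≤F (a , 1) → (a , 1) ≤F (r , s) → p < r → s < q → ⊥
¬crossing-around-integer {p = p} {q} {a} {r} {s} (_ , _ , _ , p⊥q) (_ , _ , a≤1 , _) (1≤s , _ , r≤s , r⊥s) x≤a a≤y p<r s<q =
  <⇒≱ s<q (≤-trans (≤-reflexive (0-coprimeTo-m⇒m≡1 (subst (λ p → Coprime p q) (p≡0 a≤1 x≤a a≤y) p⊥q))) 1≤s)
  where
    p≡0 : ∀ {a} → a ≤ 1 → p * 1 ≤ a * q → a * s ≤ r * 1 → p ≡ 0
    p≡0 z≤n       p≤0 _   = n≤0⇒n≡0 (subst (_≤ 0) (*-identityʳ p) p≤0)
    p≡0 (s≤s z≤n) _   s≤r = n<1⇒n≡0 (subst (p <_) r≡1 p<r)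
      where
        r≡1 : r ≡ 1
        r≡1 = r⊥s (∣-refl , subst (r ∣_) (≤-antisym r≤s (subst₂ _≤_ (+-identityʳ s) (*-identityʳ r) s≤r)) ∣-refl)

crossing-gap : ∀ {n p q a b r s} → InFarey n (p , q) → InFarey n (a , b) → InFarey n (r , s) →
  (p , q) ≤F (a , b) → (a , b) ≤F (r , s) → p < r → s < q →
  n + b + 1 < 2 * b * (fareyIndex n (r , s) ∸ fareyIndex n (p , q))
crossing-gap {b = zero} _ (() , _) _ _ _ _ _
crossing-gap {b = suc zero} x∈F ab∈F y∈F x≤ab ab≤y p<r s<q =
  ⊥-elim (¬crossing-around-integer x∈F ab∈F y∈F x≤ab ab≤y p<r s<q)
crossing-gap {n} {p} {q} {a} {b@(suc (suc _))} {r} {s} x∈F ab∈F y∈F x≤ab ab≤y p<r s<q =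
  Crossing.gap n p q a b r s (a * q ∸ b * p) (r * b ∸ a * s) (s≤s (s≤s z≤n)) x∈F ab∈F y∈F
    (sym (m∸n+n≡m (subst (_≤ a * q) (*-comm p b) x≤ab))) (sym (m∸n+n≡m ab≤y)) p<r s<q

+m-+n≡+[m∸n] : ∀ {m n} → n ≤ m → + m - + n ≡ + (m ∸ n)
+m-+n≡+[m∸n] {m} {n} n≤m = trans (ℤ.m-n≡m⊖n m n) (ℤ.⊖-≥ n≤m)

0≤[m-n]*[o-p]⁺ : ∀ {m n o p} → n ≤ m → p ≤ o → + 0 ≤ℤ (+ m - + n) *ℤ (+ o - + p)
0≤[m-n]*[o-p]⁺ {m} {n} {o} {p} n≤m p≤o = subst (+ 0 ≤ℤ_) (begin
  + ((m ∸ n) * (o ∸ p))         ≡⟨ ℤ.pos-* (m ∸ n) (o ∸ p) ⟩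
  + (m ∸ n) *ℤ + (o ∸ p)        ≡⟨ cong₂ _*ℤ_ (+m-+n≡+[m∸n] n≤m) (+m-+n≡+[m∸n] p≤o) ⟨
  (+ m - + n) *ℤ (+ o - + p)    ∎) (+≤+ z≤n)
  where open ≡-Reasoning

0≤[m-n]*[o-p]⁻ : ∀ {m n o p} → m ≤ n → o ≤ p → + 0 ≤ℤ (+ m - + n) *ℤ (+ o - + p)
0≤[m-n]*[o-p]⁻ {m} {n} {o} {p} m≤n o≤p =
  subst (+ 0 ≤ℤ_) (negate-both (+ m) (+ n) (+ o) (+ p)) (0≤[m-n]*[o-p]⁺ m≤n o≤p)
  where
    negate-both : ∀ i j k l → (j - i) *ℤ (l - k) ≡ (i - j) *ℤ (k - l)
    negate-both = ℤ-Solver.solve-∀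

similarly-ordered : ∀ m n o p → (n < m → o < p → ⊥) → (m < n → p < o → ⊥) →
  + 0 ≤ℤ (+ m - + n) *ℤ (+ o - + p)
similarly-ordered m n o p ¬[n<m∧o<p] ¬[m<n∧p<o] with m <? n | o <? p
... | yes m<n | _       = 0≤[m-n]*[o-p]⁻ (<⇒≤ m<n) (≮⇒≥ (¬[m<n∧p<o] m<n))
... | no m≮n  | yes o<p = 0≤[m-n]*[o-p]⁻ (≮⇒≥ (λ n<m → ¬[n<m∧o<p] n<m o<p)) (<⇒≤ o<p)
... | no m≮n  | no o≮p  = 0≤[m-n]*[o-p]⁺ (≮⇒≥ m≮n) (≮⇒≥ o≮p)

lemma4 : (n : ℕ) → 1 ≤ n →
    (ak bk a b al bl : ℕ) →
    InFarey n (ak , bk) → InFarey n (a , b) → InFarey n (al , bl) →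
    (ak , bk) ≤F (a , b) → (a , b) ≤F (al , bl) →
    2 * b * (fareyIndex n (al , bl) ∸ fareyIndex n (ak , bk)) ≤ n + b + 1 →
    + 0 ≤ℤ ((+ al - + ak) *ℤ (+ bl - + bk))
-- The hypothesis 1 ≤ n is implied by InFarey n (a , b).
lemma4 n _ p q a b r s x∈F ab∈F y∈F x≤ab ab≤y short = similarly-ordered r p s q
  (λ p<r s<q → <⇒≱ (crossing-gap x∈F ab∈F y∈F x≤ab ab≤y p<r s<q) short)
  (λ r<p q<s → <⇒≱ r<p (≤F∧≤den⇒≤num {p} {q} {r} {s} {{>-nonZero (proj₁ y∈F)}}
    (≤F-trans {p} {q} {a} {b} {r} {s} {{>-nonZero (proj₁ ab∈F)}} x≤ab ab≤y) (<⇒≤ q<s)))
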